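{- For every integer $n\ge1$, the packing number of $C_4\square P_n$ is $\rho(C_4\square P_n)=\left\lceil\frac{2n}{3}\right\rceil$.
   Context: $C_4$ is the cycle on 4 vertices, $P_n$ the path on $n$ vertices, and $\square$ the Cartesian product. A set $S\subseteq V(G)$ is a packing if $N[u]\cap N[v]=\varnothing$ for all distinct $u,v\in S$, where $N[v]=N(v)\cup\{v\}$; the packing number $\rho(G)$ is the maximum size of a packing of $G$. -}

module Defs where

open import Data.Nat using (ℕ; zero; suc; _+_; _*_; _≤_; _/_)
open import Data.Fin using (Fin; toℕ)
open import Data.Product using (_×_; _,_; ∃-syntax)
open import Data.Sum using (_⊎_)
open import Data.List using (List; length)
open import Data.List.Membership.Propositional using (_∈_)
open import Data.List.Relation.Unary.Unique.Propositional using (Unique)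
open import Relation.Binary.PropositionalEquality using (_≡_; _≢_)
open import Relation.Nullary using (¬_)

record Graph : Set₁ where
  field
    V   : Set
    Adj : V → V → Set

open Graph public

C4adj : Fin 4 → Fin 4 → Set
C4adj i j = (toℕ j ≡ (suc (toℕ i)) Data.Nat.% 4) ⊎ (toℕ i ≡ (suc (toℕ j)) Data.Nat.% 4)

C4 : Graph
C4 = record { V = Fin 4 ; Adj = C4adj }

Padj : {n : ℕ} → Fin n → Fin n → Set
Padj i j = (toℕ j ≡ suc (toℕ i)) ⊎ (toℕ i ≡ suc (toℕ j))

P : ℕ → Graph
P n = record { V = Fin n ; Adj = Padj }

_□_ : Graph → Graph → Graph
G □ H = record
  { V   = V G × V H
  ; Adj = λ { (g , h) (g' , h') →
              (g ≡ g' × Adj H h h') ⊎ (Adj G g g' × h ≡ h') } }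

InClosedNbhd : (G : Graph) → V G → V G → Set
InClosedNbhd G v w = (w ≡ v) ⊎ Adj G v w

IsPacking : (G : Graph) → List (V G) → Set
IsPacking G S = Unique S ×
  (∀ {u v} → u ∈ S → v ∈ S → u ≢ v →
     ¬ (∃[ w ] (InClosedNbhd G u w × InClosedNbhd G v w)))

PackingNumberIs : (G : Graph) → ℕ → Set
PackingNumberIs G k =
  (∃[ S ] (IsPacking G S × length S ≡ k)) ×
  (∀ S → IsPacking G S → length S ≤ k)

ceil3 : ℕ → ℕ
ceil3 m = (m + 2) / 3

-- Upper bound: any two vertices of one C₄-layer are at distance at most 2, and so
-- are some two of any three vertices in consecutive layers (if the first two are
-- antipodal, the third is adjacent to one of them or lies right above the first).
-- Hence a packing occupies each layer at most once and never three consecutive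
-- layers, i.e. at most 2 of every 3 layers.  Lower bound: the vertices (0, 3t) and
-- (2, 3t + 1) form a packing of size ⌈2n/3⌉, because every vertex of C₄ □ Pₙ
-- determines, from its coordinates alone, the only one of them whose closed
-- neighbourhood could contain it.
module Submission where

open import Defs
open import Data.Nat using (ℕ; _≤_; _*_)
open import Data.Nat using (zero; suc; _+_; _<_; z≤n; s≤s; pred; _≟_; _≡ᵇ_; _%_; _/_)
open import Data.Nat.Properties
open import Data.Nat.DivMod using ([m+kn]%n≡m%n; /-congˡ; +-distrib-/-∣ˡ)
open import Data.Nat.Divisibility using (divides)
open import Algebra.Properties.CommutativeSemigroup +-commutativeSemigroup using (interchange)
open import Data.Bool using (true; false; if_then_else_)
open import Data.Fin using (Fin; toℕ; suc)
open import Data.Fin.Patterns using (0F; 1F; 2F; 3F)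
open import Data.Fin.Properties using (toℕ-injective; toℕ<n)
open import Data.Product using (_×_; _,_; ∃-syntax; proj₁; proj₂)
open import Data.Sum using (_⊎_; inj₁; inj₂; [_,_])
open import Data.List using (List; []; _∷_; length; map; filter)
open import Data.List.Properties using (length-map)
open import Data.List.Membership.Propositional using (_∈_)
open import Data.List.Membership.Propositional.Properties using (∈-map⁻; ∈-filter⁻)
open import Data.List.Relation.Unary.Any using (here; there)
open import Data.List.Relation.Unary.All using ([]; _∷_; universal)
open import Data.List.Relation.Unary.All.Properties using (map⁺)
open import Data.List.Relation.Unary.AllPairs using ([]; _∷_)
open import Data.List.Relation.Unary.Unique.Propositional using (Unique)
import Data.List.Relation.Unary.Unique.Propositional.Properties as Unique
open import Function using (_∘_; Injective)
open import Relation.Binary.PropositionalEquality using (_≡_; _≢_; refl; sym; trans; cong; cong₂; subst; module ≡-Reasoning)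
open import Relation.Nullary using (¬_; Dec; contradiction)

ClosedNbhdsMeet : (G : Graph) → V G → V G → Set
ClosedNbhdsMeet G u v = ∃[ w ] (InClosedNbhd G u w × InClosedNbhd G v w)

module _ {G H : Graph} where

  nbhd-□ˡ : ∀ {g g' h} → InClosedNbhd G g g' → InClosedNbhd (G □ H) (g , h) (g' , h)
  nbhd-□ˡ (inj₁ refl) = inj₁ refl
  nbhd-□ˡ (inj₂ g~g') = inj₂ (inj₂ (g~g' , refl))

  nbhd-□ʳ : ∀ {g h h'} → InClosedNbhd H h h' → InClosedNbhd (G □ H) (g , h) (g , h')
  nbhd-□ʳ (inj₁ refl) = inj₁ refl
  nbhd-□ʳ (inj₂ h~h') = inj₂ (inj₁ (refl , h~h'))

  nbhd-□⁻ : ∀ {g g' h h'} → InClosedNbhd (G □ H) (g , h) (g' , h') →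
            (InClosedNbhd G g g' × h ≡ h') ⊎ (g ≡ g' × Adj H h h')
  nbhd-□⁻ (inj₁ refl)                 = inj₁ (inj₁ refl , refl)
  nbhd-□⁻ (inj₂ (inj₁ (refl , h~h'))) = inj₂ (refl , h~h')
  nbhd-□⁻ (inj₂ (inj₂ (g~g' , refl))) = inj₁ (inj₂ g~g' , refl)

  meet-□ˡ : ∀ {g g' h} → ClosedNbhdsMeet G g g' → ClosedNbhdsMeet (G □ H) (g , h) (g' , h)
  meet-□ˡ (w , gw , g'w) = (w , _) , nbhd-□ˡ gw , nbhd-□ˡ g'w

  meet-□ʳ : ∀ {g h h'} → ClosedNbhdsMeet H h h' → ClosedNbhdsMeet (G □ H) (g , h) (g , h')
  meet-□ʳ (w , hw , h'w) = (_ , w) , nbhd-□ʳ hw , nbhd-□ʳ h'w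

  meet-□-diagonal : ∀ {g g' h h'} → InClosedNbhd G g g' → InClosedNbhd H h' h →
                    ClosedNbhdsMeet (G □ H) (g , h) (g' , h')
  meet-□-diagonal gg' h'h = (_ , _) , nbhd-□ˡ gg' , nbhd-□ʳ h'h

meet⇒≡-via-owner : ∀ {G : Graph} {X : Set} {Chosen : V G → Set} (owner key : V G → X) →
                   Injective _≡_ _≡_ key →
                   (∀ {v w} → Chosen v → InClosedNbhd G v w → owner w ≡ key v) →
                   ∀ {u v} → Chosen u → Chosen v → ClosedNbhdsMeet G u v → u ≡ v
meet⇒≡-via-owner owner key key-injective owns cu cv (w , uw , vw) =
  key-injective (trans (sym (owns cu uw)) (owns cv vw))

antipode : Fin 4 → Fin 4
antipode 0F = 2F
antipode 1F = 3F
antipode 2F = 0F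
antipode 3F = 1F

antipode-involutive : ∀ a → antipode (antipode a) ≡ a
antipode-involutive 0F = refl
antipode-involutive 1F = refl
antipode-involutive 2F = refl
antipode-involutive 3F = refl

C4-nbhd-or-antipode : ∀ a b → InClosedNbhd C4 a b ⊎ b ≡ antipode a
C4-nbhd-or-antipode 0F 0F = inj₁ (inj₁ refl)
C4-nbhd-or-antipode 0F 1F = inj₁ (inj₂ (inj₁ refl))
C4-nbhd-or-antipode 0F 2F = inj₂ refl
C4-nbhd-or-antipode 0F 3F = inj₁ (inj₂ (inj₂ refl))
C4-nbhd-or-antipode 1F 0F = inj₁ (inj₂ (inj₂ refl))
C4-nbhd-or-antipode 1F 1F = inj₁ (inj₁ refl)
C4-nbhd-or-antipode 1F 2F = inj₁ (inj₂ (inj₁ refl))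
C4-nbhd-or-antipode 1F 3F = inj₂ refl
C4-nbhd-or-antipode 2F 0F = inj₂ refl
C4-nbhd-or-antipode 2F 1F = inj₁ (inj₂ (inj₂ refl))
C4-nbhd-or-antipode 2F 2F = inj₁ (inj₁ refl)
C4-nbhd-or-antipode 2F 3F = inj₁ (inj₂ (inj₁ refl))
C4-nbhd-or-antipode 3F 0F = inj₁ (inj₂ (inj₁ refl))
C4-nbhd-or-antipode 3F 1F = inj₂ refl
C4-nbhd-or-antipode 3F 2F = inj₁ (inj₂ (inj₂ refl))
C4-nbhd-or-antipode 3F 3F = inj₁ (inj₁ refl)

C4-meet-antipode : ∀ a → ClosedNbhdsMeet C4 a (antipode a)
C4-meet-antipode 0F = 1F , inj₂ (inj₁ refl) , inj₂ (inj₂ refl)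
C4-meet-antipode 1F = 2F , inj₂ (inj₁ refl) , inj₂ (inj₂ refl)
C4-meet-antipode 2F = 3F , inj₂ (inj₁ refl) , inj₂ (inj₂ refl)
C4-meet-antipode 3F = 0F , inj₂ (inj₁ refl) , inj₂ (inj₂ refl)

C4-meet : ∀ a b → ClosedNbhdsMeet C4 a b
C4-meet a b with C4-nbhd-or-antipode a b
... | inj₁ ab   = b , ab , inj₁ refl
... | inj₂ refl = C4-meet-antipode a

Vertex : ℕ → Set
Vertex n = V (C4 □ P n)

layer : ∀ {n} → Vertex n → ℕ
layer (_ , j) = toℕ j

distinct-layers : ∀ {n} {u v : Vertex n} → layer u < layer v → u ≢ v
distinct-layers u<v refl = <-irrefl refl u<v

meet-in-layer : ∀ {n} {u v : Vertex n} → layer u ≡ layer v → ClosedNbhdsMeet (C4 □ P n) u v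
meet-in-layer {u = a , i} {b , j} i≡j with toℕ-injective i≡j
... | refl = meet-□ˡ {C4} {P _} (C4-meet a b)

meet-in-three-consecutive-layers :
  ∀ {n} (u v w : Vertex n) → layer v ≡ suc (layer u) → layer w ≡ suc (layer v) →
  ClosedNbhdsMeet (C4 □ P n) u v ⊎ ClosedNbhdsMeet (C4 □ P n) v w ⊎ ClosedNbhdsMeet (C4 □ P n) u w
meet-in-three-consecutive-layers (a , i) (b , j) (c , l) j=i+1 l=j+1
  with C4-nbhd-or-antipode a b
... | inj₁ ab = inj₁ (meet-□-diagonal {C4} {P _} ab (inj₂ (inj₂ j=i+1)))
... | inj₂ refl with C4-nbhd-or-antipode (antipode a) c
...   | inj₁ bc   = inj₂ (inj₁ (meet-□-diagonal {C4} {P _} bc (inj₂ (inj₂ l=j+1))))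
...   | inj₂ refl rewrite antipode-involutive a =
  inj₂ (inj₂ (meet-□ʳ {C4} {P _} (j , inj₂ (inj₁ j=i+1) , inj₂ (inj₂ l=j+1))))

sumBelow : ℕ → (ℕ → ℕ) → ℕ
sumBelow zero    f = 0
sumBelow (suc n) f = f 0 + sumBelow n (f ∘ suc)

sumBelow-cong : ∀ n {f g : ℕ → ℕ} → (∀ k → f k ≡ g k) → sumBelow n f ≡ sumBelow n g
sumBelow-cong zero    f≗g = refl
sumBelow-cong (suc n) f≗g = cong₂ _+_ (f≗g 0) (sumBelow-cong n (f≗g ∘ suc))

sumBelow-zero : ∀ n → sumBelow n (λ _ → 0) ≡ 0
sumBelow-zero zero    = refl
sumBelow-zero (suc n) = sumBelow-zero n

sumBelow-+ : ∀ n (f g : ℕ → ℕ) → sumBelow n (λ k → f k + g k) ≡ sumBelow n f + sumBelow n g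
sumBelow-+ zero    f g = refl
sumBelow-+ (suc n) f g = trans (cong (f 0 + g 0 +_) (sumBelow-+ n (f ∘ suc) (g ∘ suc)))
                               (interchange (f 0) (g 0) _ _)

δ : ℕ → ℕ → ℕ
δ i k = if i ≡ᵇ k then 1 else 0

sumBelow-δ : ∀ {i n} → i < n → sumBelow n (δ i) ≡ 1
sumBelow-δ {zero}  {suc n} _         = cong suc (sumBelow-zero n)
sumBelow-δ {suc i} {suc n} (s≤s i<n) = sumBelow-δ i<n

fibreSize : ∀ {A : Set} → (A → ℕ) → List A → ℕ → ℕ
fibreSize ℓ xs k = length (filter (λ x → ℓ x ≟ k) xs)

-- The filter decision does (ℓ x ≟ k) computes to ℓ x ≡ᵇ k.
fibreSize-∷ : ∀ {A : Set} (ℓ : A → ℕ) x xs k →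
              fibreSize ℓ (x ∷ xs) k ≡ δ (ℓ x) k + fibreSize ℓ xs k
fibreSize-∷ ℓ x xs k with ℓ x ≡ᵇ k
... | true  = refl
... | false = refl

sumBelow-fibreSize : ∀ {A : Set} {n} (ℓ : A → ℕ) → (∀ x → ℓ x < n) →
                     ∀ xs → sumBelow n (fibreSize ℓ xs) ≡ length xs
sumBelow-fibreSize {n = n} ℓ ℓ<n []       = sumBelow-zero n
sumBelow-fibreSize {n = n} ℓ ℓ<n (x ∷ xs) = begin
  sumBelow n (fibreSize ℓ (x ∷ xs))                   ≡⟨ sumBelow-cong n (fibreSize-∷ ℓ x xs) ⟩
  sumBelow n (λ k → δ (ℓ x) k + fibreSize ℓ xs k)     ≡⟨ sumBelow-+ n (δ (ℓ x)) (fibreSize ℓ xs) ⟩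
  sumBelow n (δ (ℓ x)) + sumBelow n (fibreSize ℓ xs)  ≡⟨ cong₂ _+_ (sumBelow-δ (ℓ<n x)) (sumBelow-fibreSize ℓ ℓ<n xs) ⟩
  suc (length xs)                                     ∎
  where open ≡-Reasoning

fibreSize-inhabited : ∀ {A : Set} (ℓ : A → ℕ) xs k → 0 < fibreSize ℓ xs k → ∃[ x ] (x ∈ xs × ℓ x ≡ k)
fibreSize-inhabited ℓ xs k pos with filter (λ x → ℓ x ≟ k) xs in fibre
... | x ∷ _ = x , ∈-filter⁻ (λ x → ℓ x ≟ k) (subst (x ∈_) (sym fibre) (here refl))

unique-length≤1 : ∀ {A : Set} {xs : List A} → Unique xs →
                  (∀ {x y} → x ∈ xs → y ∈ xs → ¬ x ≢ y) → length xs ≤ 1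
unique-length≤1 {xs = []}              _                    _         = z≤n
unique-length≤1 {xs = _ ∷ []}          _                    _         = ≤-refl
unique-length≤1 {xs = _ ∷ _ ∷ _} ((x≢y ∷ _) ∷ _) no-distinct-pair =
  contradiction x≢y (no-distinct-pair (here refl) (there (here refl)))

ceil3-step : ∀ n → ceil3 (2 * (3 + n)) ≡ 2 + ceil3 (2 * n)
ceil3-step n = begin
  (2 * (3 + n) + 2) / 3  ≡⟨ /-congˡ {o = 3} (trans (cong (_+ 2) (*-distribˡ-+ 2 3 n))
                                                   (+-assoc 6 (2 * n) 2)) ⟩
  (6 + (2 * n + 2)) / 3  ≡⟨ +-distrib-/-∣ˡ (2 * n + 2) {d = 3} (divides 2 refl) ⟩
  2 + ceil3 (2 * n)      ∎
  where open ≡-Reasoning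

sumBelow≤ceil3 : ∀ n (f : ℕ → ℕ) → (∀ k → f k ≤ 1) → (∀ k → f k + (f (1 + k) + f (2 + k)) ≤ 2) →
                 sumBelow n f ≤ ceil3 (2 * n)
sumBelow≤ceil3 0                   f f≤1 f₃≤2 = z≤n
sumBelow≤ceil3 1                   f f≤1 f₃≤2 = +-monoˡ-≤ 0 (f≤1 0)
sumBelow≤ceil3 2                   f f≤1 f₃≤2 = +-mono-≤ (f≤1 0) (+-monoˡ-≤ 0 (f≤1 1))
sumBelow≤ceil3 (suc (suc (suc n))) f f≤1 f₃≤2 = begin
  f 0 + (f 1 + (f 2 + sumBelow n f′))  ≡⟨ cong (f 0 +_) (+-assoc (f 1) (f 2) _) ⟨
  f 0 + (f 1 + f 2 + sumBelow n f′)    ≡⟨ +-assoc (f 0) _ _ ⟨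
  f 0 + (f 1 + f 2) + sumBelow n f′    ≤⟨ +-mono-≤ (f₃≤2 0) (sumBelow≤ceil3 n f′ (f≤1 ∘ (3 +_)) (f₃≤2 ∘ (3 +_))) ⟩
  2 + ceil3 (2 * n)                    ≡⟨ ceil3-step n ⟨
  ceil3 (2 * (3 + n))                  ∎
  where
  open ≤-Reasoning
  f′ : ℕ → ℕ
  f′ = f ∘ (3 +_)

sum-of-three-bits≤2 : ∀ {x y z} → x ≤ 1 → y ≤ 1 → z ≤ 1 → ¬ (0 < x × 0 < y × 0 < z) → x + (y + z) ≤ 2
sum-of-three-bits≤2 z≤n             y≤1             z≤1             _ = +-mono-≤ y≤1 z≤1
sum-of-three-bits≤2 (s≤s z≤n)       z≤n             z≤1             _ = s≤s z≤1
sum-of-three-bits≤2 (s≤s z≤n)       (s≤s z≤n)       z≤n             _ = ≤-refl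
sum-of-three-bits≤2 x@(s≤s z≤n)     y@(s≤s z≤n)     z@(s≤s z≤n) not-all = contradiction (x , y , z) not-all

-- Upper bound

occupancy : ∀ {n} → List (Vertex n) → ℕ → ℕ
occupancy = fibreSize layer

module _ {n} {S : List (Vertex n)} where

  occupancy≤1 : IsPacking (C4 □ P n) S → ∀ k → occupancy S k ≤ 1
  occupancy≤1 (unique , disjoint) k = unique-length≤1 (Unique.filter⁺ layer≟k unique) λ u∈ v∈ u≢v →
    let u∈S , lu = ∈-filter⁻ layer≟k u∈
        v∈S , lv = ∈-filter⁻ layer≟k v∈
    in disjoint u∈S v∈S u≢v (meet-in-layer (trans lu (sym lv)))
    where
    layer≟k : (v : Vertex n) → Dec (layer v ≡ k)
    layer≟k v = layer v ≟ k

  no-three-consecutive : IsPacking (C4 □ P n) S → ∀ k →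
                         ¬ (0 < occupancy S k × 0 < occupancy S (1 + k) × 0 < occupancy S (2 + k))
  no-three-consecutive (_ , disjoint) k (occ₀ , occ₁ , occ₂)
    with fibreSize-inhabited layer S k occ₀
       | fibreSize-inhabited layer S (1 + k) occ₁
       | fibreSize-inhabited layer S (2 + k) occ₂
  ... | u , u∈ , refl | v , v∈ , v=u+1 | w , w∈ , w=u+2 =
    [ disjoint u∈ v∈ (distinct-layers u<v)
    , [ disjoint v∈ w∈ (distinct-layers v<w)
      , disjoint u∈ w∈ (distinct-layers (<-trans u<v v<w)) ] ]
    (meet-in-three-consecutive-layers u v w v=u+1 w=v+1)
    where
    w=v+1 : layer w ≡ suc (layer v)
    w=v+1 = trans w=u+2 (cong suc (sym v=u+1))
    u<v : layer u < layer v
    u<v = ≤-reflexive (sym v=u+1)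
    v<w : layer v < layer w
    v<w = ≤-reflexive (sym w=v+1)

  packing-length≤ : IsPacking (C4 □ P n) S → length S ≤ ceil3 (2 * n)
  packing-length≤ isPacking = begin
    length S                  ≡⟨ sumBelow-fibreSize layer (toℕ<n ∘ proj₂) S ⟨
    sumBelow n (occupancy S)  ≤⟨ sumBelow≤ceil3 n (occupancy S) (occupancy≤1 isPacking) three≤2 ⟩
    ceil3 (2 * n)             ∎
    where
    open ≤-Reasoning
    three≤2 : ∀ k → occupancy S k + (occupancy S (1 + k) + occupancy S (2 + k)) ≤ 2
    three≤2 k = sum-of-three-bits≤2 (occupancy≤1 isPacking k) (occupancy≤1 isPacking (1 + k))
                                    (occupancy≤1 isPacking (2 + k)) (no-three-consecutive isPacking k)

-- Lower bound

shift : ∀ {n} → Vertex n → Vertex (3 + n)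
shift (a , j) = a , suc (suc (suc j))

shift-injective : ∀ {n} → Injective _≡_ _≡_ (shift {n})
shift-injective {x = _ , _} {_ , _} refl = refl

packing : ∀ n → List (Vertex n)
packing 0                   = []
packing 1                   = (0F , 0F) ∷ []
packing 2                   = (0F , 0F) ∷ (2F , 1F) ∷ []
packing (suc (suc (suc n))) = (0F , 0F) ∷ (2F , 1F) ∷ map shift (packing n)

length-packing : ∀ n → length (packing n) ≡ ceil3 (2 * n)
length-packing 0                   = refl
length-packing 1                   = refl
length-packing 2                   = refl
length-packing (suc (suc (suc n))) =
  trans (cong (2 +_) (trans (length-map shift (packing n)) (length-packing n))) (sym (ceil3-step n))

packing-unique : ∀ n → Unique (packing n)
packing-unique 0                   = []
packing-unique 1                   = [] ∷ []
packing-unique 2                   = ((λ ()) ∷ []) ∷ [] ∷ []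
packing-unique (suc (suc (suc n))) =
  ((λ ()) ∷ map⁺ (universal (λ _ ()) _)) ∷ map⁺ (universal (λ _ ()) _) ∷
  Unique.map⁺ shift-injective (packing-unique n)

data Chosen {n} : Vertex n → Set where
  chosen₀ : ∀ {j} t → toℕ j ≡ t * 3 → Chosen (0F , j)
  chosen₂ : ∀ {j} t → toℕ j ≡ suc (t * 3) → Chosen (2F , j)

packing-chosen : ∀ n {v} → v ∈ packing n → Chosen v
packing-chosen 1                   (here refl)                 = chosen₀ 0 refl
packing-chosen 2                   (here refl)                 = chosen₀ 0 refl
packing-chosen 2                   (there (here refl))         = chosen₂ 0 refl
packing-chosen (suc (suc (suc n))) (here refl)                 = chosen₀ 0 refl
packing-chosen (suc (suc (suc n))) (there (here refl))         = chosen₂ 0 refl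
packing-chosen (suc (suc (suc n))) (there (there v∈)) with ∈-map⁻ shift v∈
... | _ , v∈packing , refl with packing-chosen n v∈packing
...   | chosen₀ t j≡3t   = chosen₀ (suc t) (cong (3 +_) j≡3t)
...   | chosen₂ t j≡3t+1 = chosen₂ (suc t) (cong (3 +_) j≡3t+1)

-- ownerAt (m mod 3) c m is the chosen vertex, (0F , 3t) or (2F , 3t + 1), whose closed
-- neighbourhood contains (c , m).  The vertices (1F , 3t + 2) and (3F , 3t + 2) lie in
-- no chosen neighbourhood; their value is arbitrary.
ownerAt : ℕ → Fin 4 → ℕ → Fin 4 × ℕ
ownerAt 0 2F m = 2F , suc m
ownerAt 0 _  m = 0F , m
ownerAt 1 0F m = 0F , pred m
ownerAt 1 _  m = 2F , m
ownerAt _ 2F m = 2F , pred m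
ownerAt _ _  m = 0F , suc m

owner : ∀ {n} → Vertex n → Fin 4 × ℕ
owner (c , m) = ownerAt (toℕ m % 3) c (toℕ m)

key : ∀ {n} → Vertex n → Fin 4 × ℕ
key (a , j) = a , toℕ j

key-injective : ∀ {n} → Injective _≡_ _≡_ (key {n})
key-injective {x = _ , _} {_ , _} eq = cong₂ _,_ (cong proj₁ eq) (toℕ-injective (cong proj₂ eq))

ownerAt-residue : ∀ r t c → ownerAt ((r + t * 3) % 3) c (r + t * 3) ≡ ownerAt (r % 3) c (r + t * 3)
ownerAt-residue r t c = cong (λ s → ownerAt s c (r + t * 3)) ([m+kn]%n≡m%n r t 3)

ownerAt-nbhd₀ : ∀ {c} m → InClosedNbhd C4 0F c → ownerAt 0 c m ≡ (0F , m)
ownerAt-nbhd₀ {0F} m _                = refl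
ownerAt-nbhd₀ {1F} m _                = refl
ownerAt-nbhd₀ {3F} m _                = refl
ownerAt-nbhd₀ {2F} m (inj₁ ())
ownerAt-nbhd₀ {2F} m (inj₂ (inj₁ ()))
ownerAt-nbhd₀ {2F} m (inj₂ (inj₂ ()))

ownerAt-nbhd₂ : ∀ {c} m → InClosedNbhd C4 2F c → ownerAt 1 c m ≡ (2F , m)
ownerAt-nbhd₂ {1F} m _                = refl
ownerAt-nbhd₂ {2F} m _                = refl
ownerAt-nbhd₂ {3F} m _                = refl
ownerAt-nbhd₂ {0F} m (inj₁ ())
ownerAt-nbhd₂ {0F} m (inj₂ (inj₁ ()))
ownerAt-nbhd₂ {0F} m (inj₂ (inj₂ ()))

owner-of-chosen-nbhd : ∀ {n} {v w : Vertex n} → Chosen v → InClosedNbhd (C4 □ P n) v w → owner w ≡ key v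
owner-of-chosen-nbhd {v = _ , j} {c , m} (chosen₀ t j≡3t) v~w with nbhd-□⁻ {C4} {P _} v~w
... | inj₁ (0F~c , refl) rewrite j≡3t = trans (ownerAt-residue 0 t c) (ownerAt-nbhd₀ (t * 3) 0F~c)
... | inj₂ (refl , inj₁ m≡j+1) rewrite m≡j+1 | j≡3t = ownerAt-residue 1 t 0F
owner-of-chosen-nbhd {v = _ , j} {c , m} (chosen₀ zero j≡0) v~w | inj₂ (refl , inj₂ j≡m+1)
  with () ← trans (sym j≡0) j≡m+1
owner-of-chosen-nbhd {v = _ , j} {c , m} (chosen₀ (suc t) j≡3t+3) v~w | inj₂ (refl , inj₂ j≡m+1)
  rewrite suc-injective (trans (sym j≡m+1) j≡3t+3) | j≡3t+3 = ownerAt-residue 2 t 0F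
owner-of-chosen-nbhd {v = _ , j} {c , m} (chosen₂ t j≡3t+1) v~w with nbhd-□⁻ {C4} {P _} v~w
... | inj₁ (2F~c , refl) rewrite j≡3t+1 = trans (ownerAt-residue 1 t c) (ownerAt-nbhd₂ (suc (t * 3)) 2F~c)
... | inj₂ (refl , inj₁ m≡j+1) rewrite m≡j+1 | j≡3t+1 = ownerAt-residue 2 t 2F
... | inj₂ (refl , inj₂ j≡m+1) rewrite suc-injective (trans (sym j≡m+1) j≡3t+1) | j≡3t+1 =
  ownerAt-residue 0 t 2F

packing-isPacking : ∀ n → IsPacking (C4 □ P n) (packing n)
packing-isPacking n = packing-unique n , λ u∈ v∈ u≢v meet →
  u≢v (meet⇒≡-via-owner owner key key-injective owner-of-chosen-nbhd
                         (packing-chosen n u∈) (packing-chosen n v∈) meet)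

-- The bound also holds for n = 0.
mainTheorem18 : ∀ (n : ℕ) → 1 ≤ n → PackingNumberIs (C4 □ P n) (ceil3 (2 * n))
mainTheorem18 n _ = (packing n , packing-isPacking n , length-packing n) , λ S → packing-length≤
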